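{- Let $Q>1$ be a power of $2$. If $u,v\in\mathbb{F}_{Q^3}^*$ satisfy $u^{Q-1}+v^{Q-1}=1$, then $uv$ is a cube in $\mathbb{F}_{Q^3}$. -}

module Defs where

open import Level using (_⊔_)
open import Data.Nat using (ℕ; zero; suc)
open import Data.Product using (∃)
open import Relation.Nullary using (¬_)
open import Algebra.Bundles using (CommutativeRing)

record IsField {c ℓ} (R : CommutativeRing c ℓ) : Set (c ⊔ ℓ) where
  open CommutativeRing R
  field
    1≉0     : ¬ (1# ≈ 0#)
    inverse : ∀ x → ¬ (x ≈ 0#) → ∃ λ y → x * y ≈ 1#

module _ {c ℓ} (R : CommutativeRing c ℓ) where
  open CommutativeRing R
  pow : Carrier → ℕ → Carrier
  pow x zero    = 1#
  pow x (suc n) = x * pow x n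

-- Write q = Q³, x = u ^ (Q − 1) and b = v ^ (Q − 1). Then x + b = 1, and both x and b have norm
-- x · x^Q · x^(Q²) = 1, because (Q − 1)(1 + Q + Q²) = q − 1. If Q ≡ 2 (mod 3), then 3 ∤ q − 1 and
-- every element is a cube. If Q ≡ 1 (mod 3), expanding the two norm equations in characteristic 2
-- gives x^(1+Q) = b or x^(1+Q) = b^Q, and either way (uv)^((q−1)/3) = (xb)^((1+Q+Q²)/3) = 1.
-- An element whose ((q − 1)/3)-th power is 1 is a cube, by counting: the q − 1 nonzero elements have
-- their cubes among the at most (q − 1)/3 roots of X^((q−1)/3) − 1, each with at most three cube
-- roots, so every such root is a cube.

module Submission where

open import Level using (Level)
open import Data.Nat as ℕ using (ℕ; zero; suc)
import Data.Nat.Properties as ℕ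
open import Data.Fin as Fin using (Fin; punchIn)
import Data.Fin.Properties as Fin
open import Data.Product as Product using (∃; _,_; proj₁; proj₂)
open import Data.Sum as Sum using (_⊎_; inj₁; inj₂; [_,_]′)
open import Function using (_∘_; _$_)
open import Relation.Nullary using (¬_; Dec; yes; no; ¬?; contradiction)
open import Relation.Unary using (Pred; Decidable)
open import Relation.Binary.PropositionalEquality as ≡ using (_≡_)
open import Algebra.Bundles using (CommutativeRing)
open import Function.Bundles using (Bijection)
open import Defs

module Counting where

  open import Data.Nat using (_+_; _*_; _≤_; _<_; z≤n; s≤s)

  open import Algebra.Properties.Semiring.Sum ℕ.+-*-semiring public

  private variable
    p q r : Level
    m k : ℕ

  𝟙 : ∀ {P : Set p} → Dec P → ℕ
  𝟙 (yes _) = 1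
  𝟙 (no _)  = 0

  count : ∀ {P : Pred (Fin m) p} → Decidable P → ℕ
  count P? = ∑[ i < _ ] 𝟙 (P? i)

  ∑-mono-≤ : ∀ {f g : Fin m → ℕ} → (∀ i → f i ≤ g i) → sum f ≤ sum g
  ∑-mono-≤ {zero}  f≤g = z≤n
  ∑-mono-≤ {suc m} f≤g = ℕ.+-mono-≤ (f≤g Fin.zero) (∑-mono-≤ (f≤g ∘ Fin.suc))

  term≤sum : ∀ (f : Fin m → ℕ) i → f i ≤ sum f
  term≤sum f Fin.zero    = ℕ.m≤m+n _ _
  term≤sum f (Fin.suc i) = ℕ.≤-trans (term≤sum (f ∘ Fin.suc) i) (ℕ.m≤n+m _ _)

  𝟙-yes : ∀ {P : Set p} (P? : Dec P) → P → 𝟙 P? ≡ 1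
  𝟙-yes (yes _) _ = ≡.refl
  𝟙-yes (no ¬p) p = contradiction p ¬p

  𝟙-mono : ∀ {P : Set p} {Q : Set q} → (P → Q) → (P? : Dec P) (Q? : Dec Q) → 𝟙 P? ≤ 𝟙 Q?
  𝟙-mono P⇒Q (yes p) (yes _) = ℕ.≤-refl
  𝟙-mono P⇒Q (yes p) (no ¬q) = contradiction (P⇒Q p) ¬q
  𝟙-mono P⇒Q (no _)  _       = z≤n

  count>0 : ∀ {P : Pred (Fin m) p} (P? : Decidable P) {j} → P j → 0 < count P?
  count>0 P? {j} Pj = ℕ.≤-trans (ℕ.≤-reflexive (≡.sym (𝟙-yes (P? j) Pj))) (term≤sum (𝟙 ∘ P?) j)

  count-empty : ∀ {P : Pred (Fin m) p} (P? : Decidable P) → (∀ i → ¬ P i) → count P? ≡ 0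
  count-empty {m} P? ∄P = ℕ.n≤0⇒n≡0 (ℕ.≤-trans (∑-mono-≤ 𝟙≤0) (ℕ.≤-reflexive (sum-replicate-zero m)))
    where
    𝟙≤0 : ∀ i → 𝟙 (P? i) ≤ 0
    𝟙≤0 i with P? i
    ... | yes p = contradiction p (∄P i)
    ... | no  _ = z≤n

  count-≡ : ∀ (j : Fin m) → count (Fin._≟ j) ≡ 1
  count-≡ {suc m} j = begin
    count (Fin._≟ j)                              ≡⟨ sum-remove {i = j} (𝟙 ∘ (Fin._≟ j)) ⟩
    𝟙 (j Fin.≟ j) + count (λ i → punchIn j i Fin.≟ j)
      ≡⟨ ≡.cong₂ _+_ (𝟙-yes (j Fin.≟ j) ≡.refl) (count-empty _ (Fin.punchInᵢ≢i j)) ⟩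
    1                                             ∎
    where open ≡.≡-Reasoning

  count-∁ : ∀ {P : Pred (Fin m) p} (P? : Decidable P) → count P? + count (¬? ∘ P?) ≡ m
  count-∁ {zero}  P? = ≡.refl
  count-∁ {suc m} P? with P? Fin.zero
  ... | yes _ = ≡.cong suc (count-∁ (P? ∘ Fin.suc))
  ... | no  _ = ≡.trans (ℕ.+-suc _ _) (≡.cong suc (count-∁ (P? ∘ Fin.suc)))

  module _ {P : Pred (Fin m) p} {Q : Pred (Fin m) q} (P? : Decidable P) (Q? : Decidable Q) where

    count-mono : (∀ {i} → P i → Q i) → count P? ≤ count Q?
    count-mono P⇒Q = ∑-mono-≤ λ i → 𝟙-mono P⇒Q (P? i) (Q? i)

    count-⊎ : ∀ {R : Pred (Fin m) r} (R? : Decidable R) → (∀ {i} → P i → Q i ⊎ R i) →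
              count P? ≤ count Q? + count R?
    count-⊎ {R = R} R? P⇒Q⊎R = ℕ.≤-trans (∑-mono-≤ λ i → 𝟙-⊎ (P? i) (Q? i) (R? i))
                                          (ℕ.≤-reflexive (∑-distrib-+ (𝟙 ∘ Q?) (𝟙 ∘ R?)))
      where
      𝟙-⊎ : ∀ {i} (p : Dec (P i)) (q : Dec (Q i)) (r : Dec (R i)) → 𝟙 p ≤ 𝟙 q + 𝟙 r
      𝟙-⊎ (no _)  _       _       = z≤n
      𝟙-⊎ (yes _) (yes _) _       = s≤s z≤n
      𝟙-⊎ (yes _) (no _)  (yes _) = ℕ.≤-refl
      𝟙-⊎ (yes p) (no ¬q) (no ¬r) with P⇒Q⊎R p
      ... | inj₁ q = contradiction q ¬q
      ... | inj₂ r = contradiction r ¬r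

    count-mono-< : (∀ {i} → P i → Q i) → ∀ {j} → Q j → ¬ P j → count P? < count Q?
    count-mono-< P⇒Q {j} Qj ¬Pj = begin
      suc (count P?)                           ≡⟨ ℕ.+-comm 1 _ ⟩
      count P? + 1                             ≡⟨ ≡.cong (count P? +_) (count-≡ j) ⟨
      count P? + count (Fin._≟ j)              ≡⟨ ∑-distrib-+ (𝟙 ∘ P?) (𝟙 ∘ (Fin._≟ j)) ⟨
      ∑[ i < m ] (𝟙 (P? i) + 𝟙 (i Fin.≟ j))   ≤⟨ ∑-mono-≤ (λ i → 𝟙-step (P? i) (i Fin.≟ j) (Q? i)) ⟩
      count Q?                                 ∎
      where
      open ℕ.≤-Reasoning
      𝟙-step : ∀ {i} (p : Dec (P i)) (e : Dec (i ≡ j)) (q : Dec (Q i)) → 𝟙 p + 𝟙 e ≤ 𝟙 q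
      𝟙-step (yes p) (yes ≡.refl) _ = contradiction p ¬Pj
      𝟙-step (yes p) (no _)       q = 𝟙-mono P⇒Q (yes p) q
      𝟙-step (no _)  e            q = 𝟙-mono (λ { ≡.refl → Qj }) e q

  count≤∑-fibres : ∀ {P : Pred (Fin m) p} {R : Fin m → Fin k → Set r}
                   (P? : Decidable P) (R? : ∀ i b → Dec (R i b)) (f : Fin m → Fin k) →
                   (∀ {i} → P i → R i (f i)) → count P? ≤ ∑[ b < k ] count (λ i → R? i b)
  count≤∑-fibres P? R? f P⇒R = ℕ.≤-trans
    (∑-mono-≤ λ i → ℕ.≤-trans (𝟙-mono P⇒R (P? i) (R? i (f i))) (term≤sum (λ b → 𝟙 (R? i b)) (f i)))
    (ℕ.≤-reflexive (∑-comm (λ i b → 𝟙 (R? i b))))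

module Arithmetic where

  open import Data.Nat using (_+_; _*_; _^_; _∸_)
  open import Data.Nat.Divisibility using (_∣_; divides)
  open import Data.Nat.Tactic.RingSolver using (solve-∀)
  open ≡ using (refl; cong; trans; sym)

  2^k-mod-3 : ∀ k → (∃ λ e → 2 ^ k ≡ 1 + 3 * e) ⊎ (∃ λ e → 2 ^ k ≡ 2 + 3 * e)
  2^k-mod-3 zero = inj₁ (0 , refl)
  2^k-mod-3 (suc k) with 2^k-mod-3 k
  ... | inj₁ (e , 2^k≡1+3e) = inj₂ (2 * e , trans (cong (2 *_) 2^k≡1+3e) (lemma e))
    where
    lemma : ∀ e → 2 * (1 + 3 * e) ≡ 2 + 3 * (2 * e)
    lemma = solve-∀
  ... | inj₂ (e , 2^k≡2+3e) = inj₁ (1 + 2 * e , trans (cong (2 *_) 2^k≡2+3e) (lemma e))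
    where
    lemma : ∀ e → 2 * (2 + 3 * e) ≡ 1 + 3 * (1 + 2 * e)
    lemma = solve-∀

  Q³∸1≡[Q∸1][1+Q+Q²] : ∀ Q → Q ^ 3 ∸ 1 ≡ (Q ∸ 1) * (1 + Q + Q * Q)
  Q³∸1≡[Q∸1][1+Q+Q²] zero    = refl
  Q³∸1≡[Q∸1][1+Q+Q²] (suc p) = cong (_∸ 1) (lemma p)
    where
    lemma : ∀ p → (1 + p) * ((1 + p) * ((1 + p) * 1)) ≡ 1 + p * (1 + (1 + p) + (1 + p) * (1 + p))
    lemma = solve-∀

  3[Q∸1]f≡Q³∸1 : ∀ Q {f} → 1 + Q + Q * Q ≡ f * 3 → 3 * ((Q ∸ 1) * f) ≡ Q ^ 3 ∸ 1
  3[Q∸1]f≡Q³∸1 Q {f} N≡f*3 = begin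
    3 * ((Q ∸ 1) * f)              ≡⟨ ℕ.*-comm 3 ((Q ∸ 1) * f) ⟩
    (Q ∸ 1) * f * 3                ≡⟨ ℕ.*-assoc (Q ∸ 1) f 3 ⟩
    (Q ∸ 1) * (f * 3)              ≡⟨ cong ((Q ∸ 1) *_) N≡f*3 ⟨
    (Q ∸ 1) * (1 + Q + Q * Q)      ≡⟨ Q³∸1≡[Q∸1][1+Q+Q²] Q ⟨
    Q ^ 3 ∸ 1                      ∎
    where open ≡.≡-Reasoning

  3∣1+2[Q³∸1] : ∀ {Q} e → Q ≡ 2 + 3 * e → 3 ∣ 1 + 2 * (Q ^ 3 ∸ 1)
  3∣1+2[Q³∸1] {Q} e refl =
    divides (5 + 24 * e + 36 * (e * e) + 18 * (e * e * e))
            (trans (cong (λ m → 1 + 2 * m) (Q³∸1≡[Q∸1][1+Q+Q²] Q)) (lemma e))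
    where
    lemma : ∀ e → 1 + 2 * ((1 + 3 * e) * (1 + (2 + 3 * e) + (2 + 3 * e) * (2 + 3 * e))) ≡
                  (5 + 24 * e + 36 * (e * e) + 18 * (e * e * e)) * 3
    lemma = solve-∀

  3∣1+Q+Q² : ∀ {Q} e → Q ≡ 1 + 3 * e → 3 ∣ 1 + Q + Q * Q
  3∣1+Q+Q² e refl = divides (1 + 3 * e + 3 * (e * e)) (lemma e)
    where
    lemma : ∀ e → 1 + (1 + 3 * e) + (1 + 3 * e) * (1 + 3 * e) ≡ (1 + 3 * e + 3 * (e * e)) * 3
    lemma = solve-∀

  3∣2+Q : ∀ {Q} e → Q ≡ 1 + 3 * e → 3 ∣ 2 + Q
  3∣2+Q e refl = divides (1 + e) (lemma e)
    where
    lemma : ∀ e → 2 + (1 + 3 * e) ≡ (1 + e) * 3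
    lemma = solve-∀

  3∣Q+[1+Q] : ∀ {Q} e → Q ≡ 1 + 3 * e → 3 ∣ Q + (1 + Q)
  3∣Q+[1+Q] e refl = divides (1 + 2 * e) (lemma e)
    where
    lemma : ∀ e → (1 + 3 * e) + (1 + (1 + 3 * e)) ≡ (1 + 2 * e) * 3
    lemma = solve-∀

module Exponentiation {c ℓ} (R : CommutativeRing c ℓ) where

  open import Data.Nat.Divisibility using (_∣_; divides)
  open CommutativeRing R
  open import Algebra.Properties.CommutativeSemiring.Exp commutativeSemiring public
  open import Algebra.Solver.Ring.NaturalCoefficients.Default commutativeSemiring
  open import Relation.Binary.Reasoning.Setoid setoid

  pow≡^ : ∀ x m → pow R x m ≡ x ^ m
  pow≡^ x zero    = ≡.refl
  pow≡^ x (suc m) = ≡.cong (x *_) (pow≡^ x m)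

  1^m≈1 : ∀ m → 1# ^ m ≈ 1#
  1^m≈1 zero    = refl
  1^m≈1 (suc m) = trans (*-identityˡ _) (1^m≈1 m)

  ^≈1-∣ : ∀ {x N a} → x ^ N ≈ 1# → N ∣ a → x ^ a ≈ 1#
  ^≈1-∣ {x} {N} x^N≈1 (divides t ≡.refl) = begin
    x ^ (t ℕ.* N)    ≡⟨ ≡.cong (x ^_) (ℕ.*-comm t N) ⟩
    x ^ (N ℕ.* t)    ≈⟨ ^-assocʳ x N t ⟨
    (x ^ N) ^ t      ≈⟨ ^-congˡ t x^N≈1 ⟩
    1# ^ t           ≈⟨ 1^m≈1 t ⟩
    1#               ∎

  x^3≈x*x*x : ∀ x → x ^ 3 ≈ x * x * x
  x^3≈x*x*x x = solve 1 (λ x → x :* (x :* (x :* con 1)) := x :* x :* x) refl x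

  ^-^-comm : ∀ x m k → (x ^ m) ^ k ≈ (x ^ k) ^ m
  ^-^-comm x m k = begin
    (x ^ m) ^ k      ≈⟨ ^-assocʳ x m k ⟩
    x ^ (m ℕ.* k)    ≡⟨ ≡.cong (x ^_) (ℕ.*-comm m k) ⟩
    x ^ (k ℕ.* m)    ≈⟨ ^-assocʳ x k m ⟨
    (x ^ k) ^ m      ∎

  norm≈^ : ∀ x Q → x * x ^ Q * (x ^ Q) ^ Q ≈ x ^ (1 ℕ.+ Q ℕ.+ Q ℕ.* Q)
  norm≈^ x Q = begin
    x * x ^ Q * (x ^ Q) ^ Q          ≈⟨ *-congˡ (^-assocʳ x Q Q) ⟩
    x ^ (1 ℕ.+ Q) * x ^ (Q ℕ.* Q)    ≈⟨ ^-homo-* x (1 ℕ.+ Q) (Q ℕ.* Q) ⟨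
    x ^ (1 ℕ.+ Q ℕ.+ Q ℕ.* Q)        ∎

module Characteristic2 {c ℓ} (R : CommutativeRing c ℓ) where

  open CommutativeRing R
  open Exponentiation R
  open import Algebra.Solver.Ring.NaturalCoefficients.Default commutativeSemiring
  open import Relation.Binary.Reasoning.Setoid setoid

  module _ (1+1≈0 : 1# + 1# ≈ 0#) where

    x+x≈0 : ∀ x → x + x ≈ 0#
    x+x≈0 x = begin
      x + x          ≈⟨ solve 1 (λ x → x :+ x := x :* (con 1 :+ con 1)) refl x ⟩
      x * (1# + 1#)  ≈⟨ *-congˡ 1+1≈0 ⟩
      x * 0#         ≈⟨ zeroʳ x ⟩
      0#             ∎

    x+y≈0⇒x≈y : ∀ {x y} → x + y ≈ 0# → x ≈ y
    x+y≈0⇒x≈y {x} {y} x+y≈0 = begin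
      x              ≈⟨ +-identityʳ x ⟨
      x + 0#         ≈⟨ +-congˡ (x+x≈0 y) ⟨
      x + (y + y)    ≈⟨ +-assoc x y y ⟨
      (x + y) + y    ≈⟨ +-congʳ x+y≈0 ⟩
      0# + y         ≈⟨ +-identityˡ y ⟩
      y              ∎

    frobenius : ∀ k x y → (x + y) ^ (2 ℕ.^ k) ≈ x ^ (2 ℕ.^ k) + y ^ (2 ℕ.^ k)
    frobenius zero    x y = solve 2 (λ x y → (x :+ y) :* con 1 := x :* con 1 :+ y :* con 1) refl x y
    frobenius (suc k) x y = begin
      (x + y) ^ (2 ℕ.* K)          ≈⟨ ^-assocʳ (x + y) 2 K ⟨
      ((x + y) ^ 2) ^ K            ≈⟨ ^-congˡ K square ⟩
      (x ^ 2 + y ^ 2) ^ K          ≈⟨ frobenius k (x ^ 2) (y ^ 2) ⟩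
      (x ^ 2) ^ K + (y ^ 2) ^ K    ≈⟨ +-cong (^-assocʳ x 2 K) (^-assocʳ y 2 K) ⟩
      x ^ (2 ℕ.* K) + y ^ (2 ℕ.* K) ∎
      where
      K = 2 ℕ.^ k
      square : (x + y) ^ 2 ≈ x ^ 2 + y ^ 2
      square = begin
        (x + y) ^ 2                        ≈⟨ solve 2 (λ x y → (x :+ y) :* ((x :+ y) :* con 1)
                                                := x :* (x :* con 1) :+ y :* (y :* con 1) :+ (x :* y :+ x :* y)) refl x y ⟩
        x ^ 2 + y ^ 2 + (x * y + x * y)    ≈⟨ +-congˡ (x+x≈0 (x * y)) ⟩
        x ^ 2 + y ^ 2 + 0#                 ≈⟨ +-identityʳ _ ⟩
        x ^ 2 + y ^ 2                      ∎

module MonicPolynomial {c ℓ} (R : CommutativeRing c ℓ) where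

  open import Data.Vec using (Vec; []; _∷_; replicate)
  open CommutativeRing R
  open Exponentiation R
  open import Algebra.Solver.Ring.NaturalCoefficients.Default commutativeSemiring
  open import Relation.Binary.Reasoning.Setoid setoid

  -- [c₀, …, c_{d-1}] is the monic polynomial c₀ + c₁X + ⋯ + c_{d-1}X^{d-1} + X^d.
  monic : ∀ {d} → Vec Carrier d → Carrier → Carrier
  monic []       x = 1#
  monic (c ∷ cs) x = c + x * monic cs x

  quotient : ∀ {d} → Carrier → Vec Carrier (suc d) → Vec Carrier d
  quotient r (c ∷ [])      = []
  quotient r (c ∷ c' ∷ cs) = monic (c' ∷ cs) r ∷ quotient r (c' ∷ cs)

  -- The solver works over the semiring, so -r is an opaque variable and -r + r is added as zero.
  private
    a≈a+[-r+r]*t : ∀ a r t → a ≈ a + (- r + r) * t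
    a≈a+[-r+r]*t a r t = sym (trans (+-congˡ (trans (*-congʳ (-‿inverseˡ r)) (zeroˡ t))) (+-identityʳ a))

  factor-theorem : ∀ {d} r (cs : Vec Carrier (suc d)) x →
                   monic cs x ≈ (x - r) * monic (quotient r cs) x + monic cs r
  factor-theorem r (c ∷ []) x = begin
    c + x * 1#                             ≈⟨ a≈a+[-r+r]*t _ r 1# ⟩
    c + x * 1# + (- r + r) * 1#            ≈⟨ solve 4 (λ c x r s → c :+ x :* con 1 :+ (s :+ r) :* con 1
                                                 := (x :+ s) :* con 1 :+ (c :+ r :* con 1)) refl c x r (- r) ⟩
    (x - r) * 1# + (c + r * 1#)            ∎
  factor-theorem r (c ∷ cs@(_ ∷ _)) x = begin
    c + x * p                              ≈⟨ +-congˡ (*-congˡ (factor-theorem r cs x)) ⟩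
    c + x * ((x - r) * q + pr)             ≈⟨ a≈a+[-r+r]*t _ r pr ⟩
    c + x * ((x - r) * q + pr) + (- r + r) * pr
      ≈⟨ solve 6 (λ c x r s q pr → c :+ x :* ((x :+ s) :* q :+ pr) :+ (s :+ r) :* pr
                                    := (x :+ s) :* (pr :+ x :* q) :+ (c :+ r :* pr)) refl c x r (- r) q pr ⟩
    (x - r) * (pr + x * q) + (c + r * pr)  ∎
    where
    p  = monic cs x
    pr = monic cs r
    q  = monic (quotient r cs) x

  monic-binomial : ∀ d c x → monic (c ∷ replicate d 0#) x ≈ c + x ^ suc d
  monic-binomial d c x = +-congˡ (*-congˡ (monic-0s d))
    where
    monic-0s : ∀ d → monic (replicate d 0#) x ≈ x ^ d
    monic-0s zero    = refl
    monic-0s (suc d) = trans (+-identityˡ _) (*-congˡ (monic-0s d))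

module FiniteField {c ℓ} (F : CommutativeRing c ℓ) (isField : IsField F) {n : ℕ}
                   (enum : Bijection (CommutativeRing.setoid F) (≡.setoid (Fin n))) where

  open import Data.Nat.Divisibility using (_∣_; divides; n∣m*n)
  open import Data.Fin.Permutation using (Permutation; permutation; _⟨$⟩ʳ_)
  open import Relation.Nullary.Decidable using (map′)

  open CommutativeRing F
  open IsField isField
  open Bijection enum using (to; injective; strictlySurjective) renaming (cong to to-cong)
  open Exponentiation F
  open import Algebra.Properties.Ring ring using (-1*x≈-x; -‿involutive)
  open import Algebra.Properties.CommutativeMonoid.Sum *-commutativeMonoid
    using () renaming (sum to ∏; sum-cong-≋ to ∏-cong; ∑-distrib-+ to ∏-distrib-*; sum-permute to ∏-permute)
  open import Algebra.Solver.Ring.NaturalCoefficients.Default commutativeSemiring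
  open import Relation.Binary.Reasoning.Setoid setoid
  open Counting

  infix 4 _≟_
  _≟_ : ∀ x y → Dec (x ≈ y)
  x ≟ y = map′ injective to-cong (to x Fin.≟ to y)

  element : Fin n → Carrier
  element b = proj₁ (strictlySurjective b)

  to-element : ∀ b → to (element b) ≡ b
  to-element b = proj₂ (strictlySurjective b)

  element-to : ∀ x → element (to x) ≈ x
  element-to x = injective (to-element (to x))

  element-injective : ∀ {b b'} → element b ≈ element b' → b ≡ b'
  element-injective {b} {b'} e = ≡.trans (≡.sym (to-element b)) (≡.trans (to-cong e) (to-element b'))

  #[_] : ∀ {p} {P : Pred Carrier p} → Decidable P → ℕ
  #[ P? ] = count (P? ∘ element)

  #-≈ : ∀ y → #[ _≟ y ] ≡ 1
  #-≈ y = ≡.trans (ℕ.≤-antisym (count-mono ((_≟ y) ∘ element) (Fin._≟ to y) ≈y⇒≡to-y)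
                               (count-mono (Fin._≟ to y) ((_≟ y) ∘ element) ≡to-y⇒≈y))
                  (count-≡ (to y))
    where
    ≈y⇒≡to-y : ∀ {b} → element b ≈ y → b ≡ to y
    ≈y⇒≡to-y b≈y = element-injective (trans b≈y (sym (element-to y)))
    ≡to-y⇒≈y : ∀ {b} → b ≡ to y → element b ≈ y
    ≡to-y⇒≈y ≡.refl = element-to y

  x⁻¹ : ∀ {x} → x ≉ 0# → Carrier
  x⁻¹ x≉0 = proj₁ (inverse _ x≉0)

  x*x⁻¹≈1 : ∀ {x} (x≉0 : x ≉ 0#) → x * x⁻¹ x≉0 ≈ 1#
  x*x⁻¹≈1 x≉0 = proj₂ (inverse _ x≉0)

  *-cancelʳ-≈1 : ∀ {x y} → x ≉ 0# → y * x ≈ x → y ≈ 1#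
  *-cancelʳ-≈1 {x} {y} x≉0 y*x≈x = begin
    y                ≈⟨ *-identityʳ y ⟨
    y * 1#           ≈⟨ *-congˡ (x*x⁻¹≈1 x≉0) ⟨
    y * (x * x⁻)     ≈⟨ *-assoc y x x⁻ ⟨
    (y * x) * x⁻     ≈⟨ *-congʳ y*x≈x ⟩
    x * x⁻           ≈⟨ x*x⁻¹≈1 x≉0 ⟩
    1#               ∎
    where x⁻ = x⁻¹ x≉0

  zero-product : ∀ {x y} → x * y ≈ 0# → x ≈ 0# ⊎ y ≈ 0#
  zero-product {x} {y} x*y≈0 with x ≟ 0#
  ... | yes x≈0 = inj₁ x≈0
  ... | no  x≉0 = inj₂ (begin
    y                ≈⟨ *-identityˡ y ⟨
    1# * y           ≈⟨ *-congʳ (x*x⁻¹≈1 x≉0) ⟨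
    (x * x⁻) * y     ≈⟨ solve 3 (λ x x' y → (x :* x') :* y := x' :* (x :* y)) refl x x⁻ y ⟩
    x⁻ * (x * y)     ≈⟨ *-congˡ x*y≈0 ⟩
    x⁻ * 0#          ≈⟨ zeroʳ x⁻ ⟩
    0#               ∎)
    where x⁻ = x⁻¹ x≉0

  *-nonzero : ∀ {x y} → x ≉ 0# → y ≉ 0# → x * y ≉ 0#
  *-nonzero x≉0 y≉0 x*y≈0 = [ x≉0 , y≉0 ]′ (zero-product x*y≈0)

  nonzero? : ∀ x → Dec (x ≉ 0#)
  nonzero? x = ¬? (x ≟ 0#)

  #-nonzero : #[ nonzero? ] ≡ n ℕ.∸ 1
  #-nonzero = ≡.cong (ℕ._∸ 1) (≡.trans (≡.cong (ℕ._+ #[ nonzero? ]) (≡.sym (#-≈ 0#)))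
                                      (count-∁ (λ b → element b ≟ 0#)))

  n≡1+[n∸1] : n ≡ suc (n ℕ.∸ 1)
  n≡1+[n∸1] with to 0#
  ... | Fin.zero  = ≡.refl
  ... | Fin.suc _ = ≡.refl

  scaling : ∀ {x} → x ≉ 0# → Permutation n n
  scaling {x} x≉0 = permutation (λ b → to (x * element b)) (λ b → to (x⁻¹ x≉0 * element b))
                                (cancel (x*x⁻¹≈1 x≉0)) (cancel (trans (*-comm _ _) (x*x⁻¹≈1 x≉0)))
    where
    cancel : ∀ {a a'} → a * a' ≈ 1# → ∀ b → to (a * element (to (a' * element b))) ≡ b
    cancel {a} {a'} a*a'≈1 b = ≡.trans (to-cong (begin
      a * element (to (a' * element b))  ≈⟨ *-congˡ (element-to _) ⟩
      a * (a' * element b)               ≈⟨ *-assoc a a' _ ⟨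
      (a * a') * element b               ≈⟨ *-congʳ a*a'≈1 ⟩
      1# * element b                     ≈⟨ *-identityˡ _ ⟩
      element b                          ∎)) (to-element b)

  element-scaling : ∀ {x} (x≉0 : x ≉ 0#) b → element (scaling x≉0 ⟨$⟩ʳ b) ≈ x * element b
  element-scaling x≉0 b = element-to _

  nonzeroOr1 : Carrier → Carrier
  nonzeroOr1 x with x ≟ 0#
  ... | yes _ = 1#
  ... | no  _ = x

  nonzeroOr1≉0 : ∀ x → nonzeroOr1 x ≉ 0#
  nonzeroOr1≉0 x with x ≟ 0#
  ... | yes _   = 1≉0
  ... | no  x≉0 = x≉0

  nonzeroOr1-scaling : ∀ {x y y'} → x ≉ 0# → y' ≈ x * y →
                       nonzeroOr1 y' ≈ x ^ 𝟙 (nonzero? y) * nonzeroOr1 y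
  nonzeroOr1-scaling {x} {y} {y'} x≉0 y'≈xy with y ≟ 0# | y' ≟ 0#
  ... | yes _   | yes _    = sym (*-identityˡ 1#)
  ... | yes y≈0 | no  y'≉0 = contradiction (trans y'≈xy (trans (*-congˡ y≈0) (zeroʳ x))) y'≉0
  ... | no  y≉0 | yes y'≈0 = contradiction (trans (sym y'≈xy) y'≈0) (*-nonzero x≉0 y≉0)
  ... | no  _   | no  _    = trans y'≈xy (*-congʳ (sym (*-identityʳ x)))

  ∏-^ : ∀ {m} x (f : Fin m → ℕ) → ∏ (λ i → x ^ f i) ≈ x ^ sum f
  ∏-^ {zero}  x f = refl
  ∏-^ {suc m} x f = trans (*-congˡ (∏-^ x (f ∘ Fin.suc))) (sym (^-homo-* x (f Fin.zero) _))

  ∏-nonzero : ∀ {m} (f : Fin m → Carrier) → (∀ i → f i ≉ 0#) → ∏ f ≉ 0#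
  ∏-nonzero {zero}  f f≉0 = 1≉0
  ∏-nonzero {suc m} f f≉0 = *-nonzero (f≉0 Fin.zero) (∏-nonzero (f ∘ Fin.suc) (f≉0 ∘ Fin.suc))

  -- Scaling by x permutes F and multiplies the product of nonzeroOr1 by x once per nonzero element.
  fermat : ∀ {x} → x ≉ 0# → x ^ (n ℕ.∸ 1) ≈ 1#
  fermat {x} x≉0 = *-cancelʳ-≈1 (∏-nonzero ι (nonzeroOr1≉0 ∘ element)) (begin
    x ^ (n ℕ.∸ 1) * ∏ ι                            ≡⟨ ≡.cong (λ m → x ^ m * ∏ ι) #-nonzero ⟨
    x ^ #[ nonzero? ] * ∏ ι                        ≈⟨ *-congʳ (∏-^ x (𝟙 ∘ nonzero? ∘ element)) ⟨
    ∏ (λ b → x ^ 𝟙 (nonzero? (element b))) * ∏ ι   ≈⟨ ∏-distrib-* _ ι ⟨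
    ∏ (λ b → x ^ 𝟙 (nonzero? (element b)) * ι b)   ≈⟨ ∏-cong (λ b → nonzeroOr1-scaling x≉0 (element-scaling x≉0 b)) ⟨
    ∏ (λ b → ι (scaling x≉0 ⟨$⟩ʳ b))               ≈⟨ ∏-permute ι (scaling x≉0) ⟨
    ∏ ι                                            ∎)
    where
    ι : Fin n → Carrier
    ι b = nonzeroOr1 (element b)

  x^n≈x : ∀ x → x ^ n ≈ x
  x^n≈x x with x ≟ 0#
  ... | yes x≈0 = begin
    x ^ n                   ≡⟨ ≡.cong (x ^_) n≡1+[n∸1] ⟩
    x * x ^ (n ℕ.∸ 1)       ≈⟨ *-congʳ x≈0 ⟩
    0# * x ^ (n ℕ.∸ 1)      ≈⟨ zeroˡ _ ⟩
    0#                      ≈⟨ x≈0 ⟨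
    x                       ∎
  ... | no x≉0 = begin
    x ^ n                   ≡⟨ ≡.cong (x ^_) n≡1+[n∸1] ⟩
    x * x ^ (n ℕ.∸ 1)       ≈⟨ *-congˡ (fermat x≉0) ⟩
    x * 1#                  ≈⟨ *-identityʳ x ⟩
    x                       ∎

  char-2 : 2 ∣ n → 1# + 1# ≈ 0#
  char-2 2∣n = begin
    1# + 1#      ≈⟨ +-congˡ -1≈1 ⟨
    1# - 1#      ≈⟨ -‿inverseʳ 1# ⟩
    0#           ∎
    where
    [-1]²≈1 : (- 1#) ^ 2 ≈ 1#
    [-1]²≈1 = trans (*-congˡ (*-identityʳ _)) (trans (-1*x≈-x (- 1#)) (-‿involutive 1#))
    -1≈1 : - 1# ≈ 1#
    -1≈1 = begin
      - 1#           ≈⟨ x^n≈x (- 1#) ⟨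
      (- 1#) ^ n     ≈⟨ ^≈1-∣ [-1]²≈1 2∣n ⟩
      1#             ∎

  unit-is-power : ∀ k t → k ∣ suc (t ℕ.* (n ℕ.∸ 1)) → ∀ {y} → y ≉ 0# → ∃ λ w → y ≈ w ^ k
  unit-is-power k t (divides R 1+t[n∸1]≡R*k) {y} y≉0 = y ^ R , (begin
    y                                ≈⟨ *-identityʳ y ⟨
    y * 1#                           ≈⟨ *-congˡ (^≈1-∣ (fermat y≉0) (n∣m*n t)) ⟨
    y * y ^ (t ℕ.* (n ℕ.∸ 1))        ≡⟨ ≡.cong (y ^_) 1+t[n∸1]≡R*k ⟩
    y ^ (R ℕ.* k)                    ≈⟨ ^-assocʳ y R k ⟨
    (y ^ R) ^ k                      ∎)

  module _ (1+1≈0 : 1# + 1# ≈ 0#) where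

    open Characteristic2 F using (x+x≈0; x+y≈0⇒x≈y)

    norm-one-dichotomy : ∀ {Q} → (∀ a b → (a + b) ^ Q ≈ a ^ Q + b ^ Q) → ∀ {x} →
                         x ^ (1 ℕ.+ Q ℕ.+ Q ℕ.* Q) ≈ 1# → (1# + x) ^ (1 ℕ.+ Q ℕ.+ Q ℕ.* Q) ≈ 1# →
                         x * x ^ Q ≈ (1# + x) ^ Q ⊎ x * x ^ Q ≈ 1# + x
    norm-one-dichotomy {Q} frobenius {x} N[x]≈1 N[1+x]≈1 =
      Sum.map (λ xy+[1+y]≈0 → trans (x+y≈0⇒x≈y 1+1≈0 xy+[1+y]≈0) (sym ([1+a]^Q≈1+a^Q x)))
              (x+y≈0⇒x≈y 1+1≈0)
              (zero-product product≈0)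
      where
      y = x ^ Q
      z = y ^ Q
      W = 1# + x + y + x * y
      xyz≈1 : x * y * z ≈ 1#
      xyz≈1 = trans (norm≈^ x Q) N[x]≈1
      [1+a]^Q≈1+a^Q : ∀ a → (1# + a) ^ Q ≈ 1# + a ^ Q
      [1+a]^Q≈1+a^Q a = trans (frobenius 1# a) (+-congʳ (1^m≈1 Q))
      [1+x][1+y][1+z]≈1 : (1# + x) * (1# + y) * (1# + z) ≈ 1#
      [1+x][1+y][1+z]≈1 = begin
        (1# + x) * (1# + y) * (1# + z)
          ≈⟨ *-cong (*-congˡ ([1+a]^Q≈1+a^Q x)) (trans (^-congˡ Q ([1+a]^Q≈1+a^Q x)) ([1+a]^Q≈1+a^Q y)) ⟨
        (1# + x) * (1# + x) ^ Q * ((1# + x) ^ Q) ^ Q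
          ≈⟨ trans (norm≈^ (1# + x) Q) N[1+x]≈1 ⟩
        1#  ∎
      -- In characteristic 2 the product equals xy·(1+x)(1+y)(1+z) + xy + (1 + xyz)·W,
      -- which vanishes because both norms are 1.
      product≈0 : (x * y + (1# + y)) * (x * y + (1# + x)) ≈ 0#
      product≈0 = begin
        (x * y + (1# + y)) * (x * y + (1# + x))
          ≈⟨ +-identityʳ _ ⟨
        (x * y + (1# + y)) * (x * y + (1# + x)) + 0#
          ≈⟨ +-congˡ (x+x≈0 1+1≈0 (x * y * z * W)) ⟨
        (x * y + (1# + y)) * (x * y + (1# + x)) + (x * y * z * W + x * y * z * W)
          ≈⟨ solve 3 (λ x y z → (x :* y :+ (con 1 :+ y)) :* (x :* y :+ (con 1 :+ x)) :+
                                 (x :* y :* z :* (con 1 :+ x :+ y :+ x :* y) :+ x :* y :* z :* (con 1 :+ x :+ y :+ x :* y))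
                              := x :* y :* ((con 1 :+ x) :* (con 1 :+ y) :* (con 1 :+ z)) :+ x :* y :+
                                 (con 1 :+ x :* y :* z) :* (con 1 :+ x :+ y :+ x :* y)) refl x y z ⟩
        x * y * ((1# + x) * (1# + y) * (1# + z)) + x * y + (1# + x * y * z) * W
          ≈⟨ +-cong (+-congʳ (*-congˡ [1+x][1+y][1+z]≈1)) (*-congʳ (+-congˡ xyz≈1)) ⟩
        x * y * 1# + x * y + (1# + 1#) * W
          ≈⟨ +-cong (trans (+-congʳ (*-identityʳ _)) (x+x≈0 1+1≈0 (x * y))) (trans (*-congʳ 1+1≈0) (zeroˡ W)) ⟩
        0# + 0#
          ≈⟨ +-identityˡ 0# ⟩
        0#  ∎

module RootCounting {c ℓ} (F : CommutativeRing c ℓ) (isField : IsField F) {n : ℕ}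
                    (enum : Bijection (CommutativeRing.setoid F) (≡.setoid (Fin n))) where

  open import Data.Nat using (_≤_; _<_; z≤n; s≤s; NonZero; >-nonZero)
  open import Data.Vec using (Vec; []; _∷_; replicate)
  open import Relation.Nullary.Decidable using (_×-dec_)
  open import Data.Fin.Properties using (any?)
  open import Data.Product using (_×_)

  open CommutativeRing F
  open import Algebra.Properties.Ring ring using (x∙y⁻¹≈ε⇒x≈y; x≈y⇒x∙y⁻¹≈ε)
  open Exponentiation F
  open MonicPolynomial F
  open IsField isField using (1≉0)
  open Bijection enum using (to)
  open FiniteField F isField enum
  open Counting
  open ℕ.≤-Reasoning

  root? : ∀ {d} (cs : Vec Carrier d) x → Dec (monic cs x ≈ 0#)
  root? cs x = monic cs x ≟ 0#

  #roots≤degree : ∀ {d} (cs : Vec Carrier d) → #[ root? cs ] ≤ d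
  #roots≤degree [] = ℕ.≤-reflexive (count-empty (root? [] ∘ element) (λ _ → 1≉0))
  #roots≤degree {suc d} cs with any? (root? cs ∘ element)
  ... | no  no-root =
    ℕ.≤-trans (ℕ.≤-reflexive (count-empty (root? cs ∘ element) (λ b root → no-root (b , root)))) z≤n
  ... | yes (b₀ , root₀) = begin
    #[ root? cs ]                             ≤⟨ count-⊎ (root? cs ∘ element) (Fin._≟ b₀) (root? qs ∘ element)
                                                         root-of-quotient ⟩
    count (Fin._≟ b₀) ℕ.+ #[ root? qs ]       ≡⟨ ≡.cong (ℕ._+ #[ root? qs ]) (count-≡ b₀) ⟩
    suc #[ root? qs ]                         ≤⟨ s≤s (#roots≤degree qs) ⟩
    suc d                                     ∎
    where
    r  = element b₀
    qs = quotient r cs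
    root-of-quotient : ∀ {b} → monic cs (element b) ≈ 0# → b ≡ b₀ ⊎ monic qs (element b) ≈ 0#
    root-of-quotient {b} root = Sum.map₁ (λ b-r≈0 → element-injective (x∙y⁻¹≈ε⇒x≈y _ _ b-r≈0))
      (zero-product (trans (sym (trans (+-congˡ root₀) (+-identityʳ _)))
                           (trans (sym (factor-theorem r cs (element b))) root)))

  #solutions≤ : ∀ k .{{_ : NonZero k}} c → #[ (λ x → x ^ k ≟ c) ] ≤ k
  #solutions≤ (suc k) c =
    ℕ.≤-trans (count-mono _ _ (λ {b} → root (element b))) (#roots≤degree (- c ∷ replicate k 0#))
    where
    root : ∀ x → x ^ suc k ≈ c → monic (- c ∷ replicate k 0#) x ≈ 0#
    root x x^k≈c = trans (monic-binomial k (- c) x) (trans (+-comm _ _) (x≈y⇒x∙y⁻¹≈ε x^k≈c))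

  -- If y is not a k-th power, every nonzero x lies in the fibre of x ^ k, and that fibre is
  -- nonempty only over an M-th root of unity other than y, where it has at most k points.
  -- There are fewer than M such roots, so n ∸ 1 = k * M would be less than k * M.
  power-criterion : ∀ k M → k ℕ.* M ≡ n ℕ.∸ 1 → ∀ {y} → y ≉ 0# → y ^ M ≈ 1# → ∃ λ w → y ≈ w ^ k
  power-criterion k M kM≡n∸1 {y} y≉0 y^M≈1 with any? (λ b → y ≟ element b ^ k)
  ... | yes (b , y≈b^k) = element b , y≈b^k
  ... | no  non-power   = contradiction n∸1≤k*#other-roots (ℕ.<⇒≱ k*#other-roots<n∸1)
    where
    0<k*M : 0 < k ℕ.* M
    0<k*M = ≡.subst (0 <_) (≡.trans #-nonzero (≡.sym kM≡n∸1))
                    (count>0 (nonzero? ∘ element) (λ y≈0 → y≉0 (trans (sym (element-to y)) y≈0)))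

    instance
      k≢0 : NonZero k
      k≢0 = ℕ.m*n≢0⇒m≢0 k {{>-nonZero 0<k*M}}
      M≢0 : NonZero M
      M≢0 = ℕ.m*n≢0⇒n≢0 k {{>-nonZero 0<k*M}}

    other-root? : ∀ x → Dec (x ^ M ≈ 1# × x ≉ y)
    other-root? x = (x ^ M ≟ 1#) ×-dec ¬? (x ≟ y)

    fibre? : ∀ i b → Dec (element i ≉ 0# × element i ^ k ≈ element b)
    fibre? i b = nonzero? (element i) ×-dec (element i ^ k ≟ element b)

    fibre⇒other-root : ∀ {i b} → element i ≉ 0# × element i ^ k ≈ element b →
                       element b ^ M ≈ 1# × element b ≉ y
    fibre⇒other-root {i} (i≉0 , i^k≈b) =
      trans (^-congˡ M (sym i^k≈b)) (trans (^-assocʳ _ k M) (trans (^-congʳ _ kM≡n∸1) (fermat i≉0))) ,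
      λ b≈y → non-power (i , trans (sym b≈y) (sym i^k≈b))

    #fibre≤ : ∀ b → count (λ i → fibre? i b) ≤ k ℕ.* 𝟙 (other-root? (element b))
    #fibre≤ b with other-root? (element b)
    ... | yes _ = begin
      count (λ i → fibre? i b)         ≤⟨ count-mono (λ i → fibre? i b) (λ i → element i ^ k ≟ element b) proj₂ ⟩
      #[ (λ x → x ^ k ≟ element b) ]   ≤⟨ #solutions≤ k (element b) ⟩
      k                                ≡⟨ ℕ.*-identityʳ k ⟨
      k ℕ.* 1                          ∎
    ... | no ¬other-root =
      ℕ.≤-trans (ℕ.≤-reflexive (count-empty (λ i → fibre? i b) (λ _ → ¬other-root ∘ fibre⇒other-root))) z≤n

    n∸1≤k*#other-roots : n ℕ.∸ 1 ≤ k ℕ.* #[ other-root? ]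
    n∸1≤k*#other-roots = begin
      n ℕ.∸ 1                                          ≡⟨ #-nonzero ⟨
      #[ nonzero? ]                                    ≤⟨ count≤∑-fibres (nonzero? ∘ element) fibre? (λ i → to (element i ^ k))
                                                                         (λ i≉0 → i≉0 , sym (element-to _)) ⟩
      ∑[ b < n ] count (λ i → fibre? i b)              ≤⟨ ∑-mono-≤ #fibre≤ ⟩
      ∑[ b < n ] (k ℕ.* 𝟙 (other-root? (element b)))   ≡⟨ *-distribˡ-sum k (𝟙 ∘ other-root? ∘ element) ⟨
      k ℕ.* #[ other-root? ]                           ∎

    #other-roots<M : #[ other-root? ] < M
    #other-roots<M = begin-strict
      #[ other-root? ]          <⟨ count-mono-< (other-root? ∘ element) (λ b → element b ^ M ≟ 1#) proj₁
                                                (trans (^-congˡ M (element-to y)) y^M≈1)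
                                                (λ other → proj₂ other (element-to y)) ⟩
      #[ (λ x → x ^ M ≟ 1#) ]   ≤⟨ #solutions≤ M 1# ⟩
      M                         ∎

    k*#other-roots<n∸1 : k ℕ.* #[ other-root? ] < n ℕ.∸ 1
    k*#other-roots<n∸1 = ≡.subst (k ℕ.* #[ other-root? ] <_) kM≡n∸1 (ℕ.*-monoʳ-< k #other-roots<M)

module FieldOfOrderQ³ {c ℓ} (F : CommutativeRing c ℓ) (isField : IsField F) (Q : ℕ)
                      (enum : Bijection (CommutativeRing.setoid F) (≡.setoid (Fin (Q ℕ.^ 3)))) where

  open import Data.Nat.Divisibility using (_∣_; m∣m*n)
  open CommutativeRing F
  open Exponentiation F
  open FiniteField F isField enum
  open RootCounting F isField enum using (power-criterion)
  open Characteristic2 F using (x+y≈0⇒x≈y)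
  open Arithmetic
  open import Relation.Binary.Reasoning.Setoid setoid

  ^Q≈1⇒≈1 : ∀ {x} → x ^ Q ≈ 1# → x ≈ 1#
  ^Q≈1⇒≈1 {x} x^Q≈1 = begin
    x               ≈⟨ x^n≈x x ⟨
    x ^ (Q ℕ.^ 3)   ≈⟨ ^≈1-∣ x^Q≈1 (m∣m*n {Q} (Q ℕ.^ 2)) ⟩
    1#              ∎

  private
    cube : ∀ {y} → ∃ (λ w → y ≈ w ^ 3) → ∃ λ w → y ≈ w * w * w
    cube = Product.map₂ (λ y≈w^3 → trans y≈w^3 (x^3≈x*x*x _))

  unit-is-cube : ∀ e → Q ≡ 2 ℕ.+ 3 ℕ.* e → ∀ {y} → y ≉ 0# → ∃ λ w → y ≈ w * w * w
  unit-is-cube e Q≡2+3e y≉0 = cube (unit-is-power 3 2 (3∣1+2[Q³∸1] e Q≡2+3e) y≉0)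

  product-is-cube : ∀ e → Q ≡ 1 ℕ.+ 3 ℕ.* e → 1# + 1# ≈ 0# → (∀ a b → (a + b) ^ Q ≈ a ^ Q + b ^ Q) →
                    ∀ {u v} → u ≉ 0# → v ≉ 0# → u ^ (Q ℕ.∸ 1) + v ^ (Q ℕ.∸ 1) ≈ 1# →
                    ∃ λ w → u * v ≈ w * w * w
  product-is-cube e Q≡1+3e 1+1≈0 frobenius {u} {v} u≉0 v≉0 x+b≈1 = cube $
    power-criterion 3 M 3M≡n∸1 (*-nonzero u≉0 v≉0) (trans [uv]^M≈[xb]^f [xb]^f≈1)
    where
    p N f M : ℕ
    p = Q ℕ.∸ 1
    N = 1 ℕ.+ Q ℕ.+ Q ℕ.* Q
    f = _∣_.quotient (3∣1+Q+Q² e Q≡1+3e)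
    M = p ℕ.* f

    N≡f*3 : N ≡ f ℕ.* 3
    N≡f*3 = _∣_.equality (3∣1+Q+Q² e Q≡1+3e)

    3M≡n∸1 : 3 ℕ.* M ≡ Q ℕ.^ 3 ℕ.∸ 1
    3M≡n∸1 = 3[Q∸1]f≡Q³∸1 Q N≡f*3

    N[_]≈1 : ∀ {z} → z ≉ 0# → (z ^ p) ^ N ≈ 1#
    N[_]≈1 {z} z≉0 = begin
      (z ^ p) ^ N          ≈⟨ ^-assocʳ z p N ⟩
      z ^ (p ℕ.* N)        ≡⟨ ≡.cong (z ^_) (Q³∸1≡[Q∸1][1+Q+Q²] Q) ⟨
      z ^ (Q ℕ.^ 3 ℕ.∸ 1)  ≈⟨ fermat z≉0 ⟩
      1#                   ∎

    x b w : Carrier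
    x = u ^ p
    b = v ^ p
    w = x ^ f

    w³≈1 : w ^ 3 ≈ 1#
    w³≈1 = trans (^-assocʳ x f 3) (trans (^-congʳ x (≡.sym N≡f*3)) N[ u≉0 ]≈1)

    b≈1+x : b ≈ 1# + x
    b≈1+x = sym (x+y≈0⇒x≈y 1+1≈0 (begin
      (1# + x) + b    ≈⟨ +-assoc 1# x b ⟩
      1# + (x + b)    ≈⟨ +-congˡ x+b≈1 ⟩
      1# + 1#         ≈⟨ 1+1≈0 ⟩
      0#              ∎))

    [uv]^M≈[xb]^f : (u * v) ^ M ≈ (x * b) ^ f
    [uv]^M≈[xb]^f = trans (sym (^-assocʳ (u * v) p f)) (^-congˡ f (^-distrib-* u v p))

    N[x]≈1 : x ^ N ≈ 1#
    N[x]≈1 = N[ u≉0 ]≈1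

    N[1+x]≈1 : (1# + x) ^ N ≈ 1#
    N[1+x]≈1 = trans (^-congˡ N (sym b≈1+x)) N[ v≉0 ]≈1

    dichotomy : x * x ^ Q ≈ (1# + x) ^ Q ⊎ x * x ^ Q ≈ 1# + x
    dichotomy = norm-one-dichotomy 1+1≈0 {Q} frobenius {x} N[x]≈1 N[1+x]≈1

    [xb]^f≈1 : (x * b) ^ f ≈ 1#
    [xb]^f≈1 = [ from-b^Q , from-b ]′ dichotomy
      where
      from-b^Q : x * x ^ Q ≈ (1# + x) ^ Q → (x * b) ^ f ≈ 1#
      from-b^Q x^[1+Q]≈[1+x]^Q = ^Q≈1⇒≈1 (begin
        ((x * b) ^ f) ^ Q                ≈⟨ ^-^-comm (x * b) f Q ⟩
        ((x * b) ^ Q) ^ f                ≈⟨ ^-congˡ f (^-distrib-* x b Q) ⟩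
        (x ^ Q * b ^ Q) ^ f              ≈⟨ ^-congˡ f (*-congˡ {x ^ Q} (trans (^-congˡ Q b≈1+x) (sym x^[1+Q]≈[1+x]^Q))) ⟩
        (x ^ Q * x ^ (1 ℕ.+ Q)) ^ f      ≈⟨ ^-congˡ f (^-homo-* x Q (1 ℕ.+ Q)) ⟨
        (x ^ (Q ℕ.+ (1 ℕ.+ Q))) ^ f      ≈⟨ ^-^-comm x (Q ℕ.+ (1 ℕ.+ Q)) f ⟩
        w ^ (Q ℕ.+ (1 ℕ.+ Q))            ≈⟨ ^≈1-∣ w³≈1 (3∣Q+[1+Q] e Q≡1+3e) ⟩
        1#                               ∎)
      from-b : x * x ^ Q ≈ 1# + x → (x * b) ^ f ≈ 1#
      from-b x^[1+Q]≈1+x = begin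
        (x * b) ^ f                      ≈⟨ ^-congˡ f (*-congˡ {x} (trans b≈1+x (sym x^[1+Q]≈1+x))) ⟩
        (x * x ^ (1 ℕ.+ Q)) ^ f          ≈⟨ ^-^-comm x (2 ℕ.+ Q) f ⟩
        w ^ (2 ℕ.+ Q)                    ≈⟨ ^≈1-∣ w³≈1 (3∣2+Q e Q≡1+3e) ⟩
        1#                               ∎

open import Data.Nat using (_^_; _∸_; _≤_)
open import Data.Nat.Divisibility using (∣m⇒∣m*n; m∣m*n)
open import Relation.Binary.PropositionalEquality using (setoid)

theorem2 : ∀ {c ℓ} (k : ℕ) → 1 ≤ k →
    (F : CommutativeRing c ℓ) → IsField F →
    Bijection (CommutativeRing.setoid F) (setoid (Fin ((2 ^ k) ^ 3))) →
    let open CommutativeRing F in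
    ∀ (u v : Carrier) → ¬ (u ≈ 0#) → ¬ (v ≈ 0#) →
    pow F u (2 ^ k ∸ 1) + pow F v (2 ^ k ∸ 1) ≈ 1# →
    ∃ λ w → u * v ≈ w * w * w
theorem2 (suc k) _ F isField enum u v u≉0 v≉0 Σ≈1 =
  [ (λ (e , Q≡1+3e) → product-is-cube e Q≡1+3e 1+1≈0 (frobenius 1+1≈0 (suc k)) u≉0 v≉0
                        (≡.subst₂ (λ a b → a + b ≈ 1#) (pow≡^ u (2 ^ suc k ∸ 1)) (pow≡^ v (2 ^ suc k ∸ 1))
                                  Σ≈1))
  , (λ (e , Q≡2+3e) → unit-is-cube e Q≡2+3e (*-nonzero u≉0 v≉0))
  ]′ (Arithmetic.2^k-mod-3 (suc k))
  where
  open CommutativeRing F using (_≈_; _+_; 0#; 1#)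
  open Exponentiation F using (pow≡^)
  open Characteristic2 F using (frobenius)
  open FiniteField F isField enum using (char-2; *-nonzero)
  open FieldOfOrderQ³ F isField (2 ^ suc k) enum

  1+1≈0 : 1# + 1# ≈ 0#
  1+1≈0 = char-2 (∣m⇒∣m*n _ (m∣m*n (2 ^ k)))
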